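{- Let $b\ge 2$ and $m\ge 1$ be integers, let $\Sigma$ be an alphabet with $m$ letters, let $\sigma:\Sigma\to\Sigma$ be a cyclic permutation of $\Sigma$ (a single $m$-cycle), let $\overline{\alpha}\in\Sigma$, and let $\mathbf{t}$ be the generalized Thue–Morse word defined by $b,m,\sigma,\overline{\alpha}$. Then the critical exponent of $\mathbf{t}$ is \[ E(\mathbf{t})=\begin{cases}\infty & \text{if } m\mid (b-1),\\ 2b/m & \text{if } m\nmid (b-1) \text{ and } b>m,\\ 2 & \text{if } b\le m.\end{cases}\]
   Context: Let $\mu:\Sigma^*\to\Sigma^*$ be the morphism defined on letters by $\mu(\alpha)=\sigma^0(\alpha)\sigma^1(\alpha)\sigma^2(\alpha)\cdots\sigma^{b-1}(\alpha)$. The generalized Thue–Morse word is the infinite word $\mathbf{t}=\lim_{n\to\infty}\mu^n(\overline{\alpha})=\mathbf{t}[0]\mathbf{t}[1]\mathbf{t}[2]\cdots$; equivalently $\mathbf{t}[n]=\sigma^{s_b(n)}(\overline{\alpha})$, where $s_b(n)$ is the sum of the digits of $n$ in base $b$. For a nonempty finite word $w$ and a rational $r>0$ with $r|w|\in\mathbb N$, the rational power is $w^r=w^{\lfloor r\rfloor}p$ where $p$ is the prefix of $w$ of length $(r-\lfloor r\rfloor)|w|$. For a factor $w$ of an infinite word $\mathbf{x}$, $\textsc{Index}(w)=\max\{r\in\mathbb Q: w^r \text{ is a factor of } \mathbf{x}\}$ if this maximum exists, and $\infty$ otherwise. The critical exponent is $E(\mathbf{x})=\sup\{\textsc{Index}(w):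 w \text{ a nonempty factor of } \mathbf{x}\}$. -}

module Defs where

open import Data.Nat as ℕ using (ℕ; zero; suc; _≤_; _<_; _∸_; _*_; _+_)
open import Data.Fin using (Fin; toℕ; fromℕ<)
open import Data.List using (List; length; lookup; take; concat; replicate; map)
open import Data.Nat.ListAction using (sum)
open import Data.Product using (Σ; ∃; ∃-syntax; _×_; proj₁)
open import Data.Integer using (+_)
open import Data.Rational as ℚ using (ℚ; _/_)
open import Data.Digit using (toDigits)
open import Relation.Nullary.Decidable using (fromWitness)
open import Relation.Binary.PropositionalEquality using (_≡_)
open import Function using (Injective)

iter : ∀ {A : Set} → (A → A) → ℕ → A → A
iter f zero    x = x
iter f (suc k) x = f (iter f k x)

-- σ is a cyclic permutation of Σ (a single |Σ|-cycle):
-- a bijection whose powers act transitively on Σ.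
IsCyclicPerm : ∀ {A : Set} → (A → A) → Set
IsCyclicPerm {A} σ = Injective _≡_ _≡_ σ × (∀ (x y : A) → ∃[ k ] iter σ k x ≡ y)

digitSum : (b : ℕ) → 2 ≤ b → ℕ → ℕ
digitSum b b≥2 n = sum (map toℕ (proj₁ (toDigits b {fromWitness b≥2} n)))

thueMorse : ∀ {A : Set} (b : ℕ) → 2 ≤ b → (A → A) → A → ℕ → A
thueMorse b b≥2 σ α n = iter σ (digitSum b b≥2 n) α

OccursAt : ∀ {A : Set} → (ℕ → A) → List A → ℕ → Set
OccursAt x w i = ∀ j (p : j < length w) → x (i + j) ≡ lookup w (fromℕ< p)

IsFactor : ∀ {A : Set} → (ℕ → A) → List A → Set
IsFactor x w = ∃[ i ] OccursAt x w i

-- the prefix of length N of w w w ⋯ ; for N = r|w| this is the rational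
-- power w^r = w^⌊r⌋ p (p the prefix of w of length (r-⌊r⌋)|w|)
ratPow : ∀ {A : Set} → List A → ℕ → List A
ratPow w N = take N (concat (replicate (suc N) w))

ℕtoℚ : ℕ → ℚ
ℕtoℚ n = (+ n) / 1

PowerFactor : ∀ {A : Set} → (ℕ → A) → List A → ℚ → Set
PowerFactor x w r =
  (ℚ.0ℚ ℚ.< r) × Σ ℕ (λ N → (r ℚ.* ℕtoℚ (length w) ≡ ℕtoℚ N) × IsFactor x (ratPow w N))

-- r is realised as a power exponent: some nonempty factor w has w^r a factor.
-- E(x) = sup { Index(w) } = sup of all such r.
ExponentOf : ∀ {A : Set} → (ℕ → A) → ℚ → Set
ExponentOf x r = ∃[ w ] (1 ≤ length w × IsFactor x w × PowerFactor x w r)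

CritExpInfinite : ∀ {A : Set} → (ℕ → A) → Set
CritExpInfinite x = ∀ (q : ℚ) → ∃[ r ] (ExponentOf x r × q ℚ.< r)

CritExpEquals : ∀ {A : Set} → (ℕ → A) → ℚ → Set
CritExpEquals x c =
  (∀ r → ExponentOf x r → r ℚ.≤ c) ×
  (∀ (q : ℚ) → q ℚ.< c → ∃[ r ] (ExponentOf x r × q ℚ.< r))

-- Inside a block of b letters t climbs the σ-orbit
-- (t (n + 1) = σ (t n) unless the last digit of n is b − 1), and an exponent r of
-- t is the same thing as a window [k, k + N) of t with period p and N = r p.
-- If m ∣ b − 1 then s_b n ≡ n (mod m), so t itself has period m.  Otherwise every
-- window satisfies m N ≤ 2 max(b, m) p, by induction on p: if b ∤ p and N > 2p,
-- periodicity spreads the ascents over the whole window, which is then shorter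
-- than 2b (descents occur within every 2b positions) and forces σ^p to fix a
-- letter, so m ≤ p; if p = q b, reading the window block by block gives a window
-- of period q.  This gives E(t) ≤ 2b/m, resp. ≤ 2, with equality witnessed by the
-- 2b letters after the number written with m − 1 digits b − 1 (period m), resp.
-- by the square of period b − 1 at position 1.
module Submission where

open import Defs
open import Data.Nat using (ℕ; _≤_; _<_; _∸_; _*_; NonZero)
open import Data.Nat.Divisibility using (_∣_)
open import Data.Fin using (Fin)
open import Data.Integer using (+_)
open import Data.Rational using (_/_)
open import Data.Product using (_×_)
open import Relation.Nullary using (¬_; Dec; yes; no)

open import Data.Nat using (zero; suc; _+_; _⊓_; _⊔_; z≤n; s≤s; z<s; >-nonZero; >-nonZero⁻¹)
open import Data.Nat.Properties
open import Data.Nat.DivMod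
  using (_%_; m≡m%n+[m/n]*n; m%n<n; [m+kn]%n≡m%n; m<n⇒m%n≡m; m*n%n≡0; m/n*n≡m; m/n<m; m≥n⇒m/n>0)
  renaming (_/_ to _div_)
open import Data.Nat.Divisibility using (divides; m%n≡0⇒n∣m; ∣⇒≤; ∣-trans; n∣m*n)
open import Data.Fin using (toℕ; fromℕ<)
open import Data.Fin.Properties using (toℕ<n; toℕ-fromℕ<; pigeonhole; injective⇒≤; nonZeroIndex)
open import Data.List using (List; []; _∷_; _++_; length; take; concat; replicate; map)
open import Data.List.Properties using (length-++; length-take; take-take; ++-assoc; ++-identityʳ)
open import Data.Product using (∃-syntax; _,_; proj₁; proj₂)
open import Data.Digit using (Expansion; fromDigits; toDigits)
open import Data.Nat.ListAction using (sum)
open import Data.Nat.Induction using (<-rec)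
open import Data.Nat.Tactic.RingSolver using (solve-∀)
open import Relation.Nullary.Decidable using (fromWitness)
open import Data.Empty using (⊥-elim)
open import Data.Sum using (_⊎_; inj₁; inj₂; [_,_]′)
open import Function using (Injective; id; _∘_)
open import Relation.Binary.PropositionalEquality
import Data.Integer as ℤ
import Data.Integer.Properties as ℤ
import Data.Rational as ℚ
import Data.Rational.Properties as ℚ
import Data.Rational.Unnormalised as ℚᵘ
import Data.Rational.Unnormalised.Properties as ℚᵘ

-- Iterates and cyclic permutations

module _ {A : Set} (f : A → A) where

  iter-+ : ∀ a c x → iter f (a + c) x ≡ iter f a (iter f c x)
  iter-+ zero    c x = refl
  iter-+ (suc a) c x = cong f (iter-+ a c x)

  iter-comm : ∀ a c x → iter f a (iter f c x) ≡ iter f c (iter f a x)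
  iter-comm a c x = begin
    iter f a (iter f c x) ≡⟨ iter-+ a c x ⟨
    iter f (a + c) x      ≡⟨ cong (λ n → iter f n x) (+-comm a c) ⟩
    iter f (c + a) x      ≡⟨ iter-+ c a x ⟩
    iter f c (iter f a x) ∎
    where open ≡-Reasoning

  iter-injective : Injective _≡_ _≡_ f → ∀ k {x y} → iter f k x ≡ iter f k y → x ≡ y
  iter-injective f-inj zero    eq = eq
  iter-injective f-inj (suc k) eq = iter-injective f-inj k (f-inj eq)

  module _ {j : ℕ} (fʲ≗id : ∀ x → iter f j x ≡ x) where

    iter-*-id : ∀ q x → iter f (q * j) x ≡ x
    iter-*-id zero    x = refl
    iter-*-id (suc q) x = trans (iter-+ j (q * j) x) (trans (cong (iter f j) (iter-*-id q x)) (fʲ≗id x))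

    iter-% : .{{_ : NonZero j}} → ∀ k x → iter f k x ≡ iter f (k % j) x
    iter-% k x = begin
      iter f k x                              ≡⟨ cong (λ n → iter f n x) (m≡m%n+[m/n]*n k j) ⟩
      iter f (k % j + k div j * j) x          ≡⟨ iter-+ (k % j) _ x ⟩
      iter f (k % j) (iter f (k div j * j) x) ≡⟨ cong (iter f (k % j)) (iter-*-id (k div j) x) ⟩
      iter f (k % j) x                        ∎
      where open ≡-Reasoning

module CyclicPermutation {m : ℕ} (σ : Fin m → Fin m) (cyc : IsCyclicPerm σ) where

  fixed-point⇒iter-id : ∀ j y → iter σ j y ≡ y → ∀ z → iter σ j z ≡ z
  fixed-point⇒iter-id j y fix z with proj₂ cyc y z
  ... | k , refl = trans (iter-comm σ j k y) (cong (iter σ k) fix)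

  -- Reducing exponents mod j would inject the orbit Fin m of any point into Fin j.
  no-shorter-period : ∀ j → 0 < j → j < m → ¬ (∀ y → iter σ j y ≡ y)
  no-shorter-period j 0<j j<m σʲ≗id = <⇒≱ j<m (injective⇒≤ residue-injective)
    where
    open ≡-Reasoning
    instance _ = >-nonZero 0<j
    y₀ : Fin m
    y₀ = fromℕ< (<-trans 0<j j<m)
    exponent : Fin m → ℕ
    exponent z = proj₁ (proj₂ cyc y₀ z)
    residue : Fin m → Fin j
    residue z = fromℕ< (m%n<n (exponent z) j)
    reach : ∀ z → iter σ (exponent z % j) y₀ ≡ z
    reach z = trans (sym (iter-% σ σʲ≗id (exponent z) y₀)) (proj₂ (proj₂ cyc y₀ z))
    residue-injective : Injective _≡_ _≡_ residue
    residue-injective {z} {z′} eq = begin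
      z                                ≡⟨ reach z ⟨
      iter σ (exponent z % j) y₀       ≡⟨ cong (λ n → iter σ n y₀) same-residue ⟩
      iter σ (exponent z′ % j) y₀      ≡⟨ reach z′ ⟩
      z′                               ∎
      where
      same-residue : exponent z % j ≡ exponent z′ % j
      same-residue = trans (sym (toℕ-fromℕ< _)) (trans (cong toℕ eq) (toℕ-fromℕ< _))

  iter-order : ∀ y → iter σ m y ≡ y
  iter-order y with pigeonhole (n<1+n m) (λ i → iter σ (toℕ i) y)
  ... | i , j , i<j , σⁱ≡σʲ = subst (λ n → iter σ n y ≡ y) e≡m σᵉy≡y
    where
    open ≡-Reasoning
    e = toℕ j ∸ toℕ i
    σᵉy≡y : iter σ e y ≡ y
    σᵉy≡y = iter-injective σ (proj₁ cyc) (toℕ i) (begin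
      iter σ (toℕ i) (iter σ e y) ≡⟨ iter-+ σ (toℕ i) e y ⟨
      iter σ (toℕ i + e) y        ≡⟨ cong (λ n → iter σ n y) (m+[n∸m]≡n (<⇒≤ i<j)) ⟩
      iter σ (toℕ j) y            ≡⟨ σⁱ≡σʲ ⟨
      iter σ (toℕ i) y            ∎)
    e≡m : e ≡ m
    e≡m with m≤n⇒m<n∨m≡n (≤-trans (m∸n≤m (toℕ j) (toℕ i)) (≤-pred (toℕ<n j)))
    ... | inj₂ e≡m = e≡m
    ... | inj₁ e<m = ⊥-elim (no-shorter-period e (m<n⇒0<n∸m i<j) e<m (fixed-point⇒iter-id e y σᵉy≡y))

  iter-fixed⇒∣ : ∀ j y → iter σ j y ≡ y → m ∣ j
  iter-fixed⇒∣ j y fix = m%n≡0⇒n∣m j m j%m≡0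
    where
    instance _ = nonZeroIndex y
    σ^[j%m]≗id : ∀ z → iter σ (j % m) z ≡ z
    σ^[j%m]≗id z = trans (sym (iter-% σ iter-order j z)) (fixed-point⇒iter-id j y fix z)
    j%m≡0 : j % m ≡ 0
    j%m≡0 with j % m in eq
    ... | zero  = refl
    ... | suc r = ⊥-elim (no-shorter-period (suc r) z<s (subst (_< m) eq (m%n<n j m))
                                                       (subst (λ n → ∀ z → iter σ n z ≡ z) eq σ^[j%m]≗id))

  ∣⇒iter-id : ∀ {j} → m ∣ j → ∀ y → iter σ j y ≡ y
  ∣⇒iter-id (divides q refl) = iter-*-id σ iter-order q

-- Base-b positions and digit sums

divMod-unique : ∀ {b d e x y} .{{_ : NonZero b}} → d < b → e < b → d + x * b ≡ e + y * b → d ≡ e × x ≡ y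
divMod-unique {b} {d} {e} {x} {y} d<b e<b eq =
  d≡e , *-cancelʳ-≡ x y b (+-cancelˡ-≡ d _ _ (trans eq (cong (_+ y * b) (sym d≡e))))
  where
  open ≡-Reasoning
  d≡e : d ≡ e
  d≡e = begin
    d               ≡⟨ m<n⇒m%n≡m d<b ⟨
    d % b           ≡⟨ [m+kn]%n≡m%n d x b ⟨
    (d + x * b) % b ≡⟨ cong (_% b) eq ⟩
    (e + y * b) % b ≡⟨ [m+kn]%n≡m%n e y b ⟩
    e % b           ≡⟨ m<n⇒m%n≡m e<b ⟩
    e               ∎

block-position : ∀ {b} .{{_ : NonZero b}} k i → k + i * b ≡ k % b + (k div b + i) * b
block-position {b} k i = begin
  k + i * b                       ≡⟨ cong (_+ i * b) (m≡m%n+[m/n]*n k b) ⟩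
  k % b + k div b * b + i * b     ≡⟨ +-assoc (k % b) _ _ ⟩
  k % b + (k div b * b + i * b)   ≡⟨ cong (_+_ (k % b)) (*-distribʳ-+ b (k div b) i) ⟨
  k % b + (k div b + i) * b       ∎
  where open ≡-Reasoning

ceiling-multiple : ∀ b .{{_ : NonZero b}} M → ∃[ c ] (M ≤ c * b × (∀ i → i < c → i * b < M))
ceiling-multiple b zero = 0 , z≤n , λ i ()
ceiling-multiple b (suc M) with ceiling-multiple b M
... | c , M≤cb , below with suc M ≤? c * b
...   | yes sM≤cb = c , sM≤cb , λ i i<c → m<n⇒m<1+n (below i i<c)
...   | no  sM≰cb =
  suc c , subst (λ n → suc n ≤ suc c * b) (sym M≡cb) (+-monoˡ-≤ (c * b) (>-nonZero⁻¹ b)) , below′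
  where
  M≡cb : M ≡ c * b
  M≡cb = ≤-antisym M≤cb (≤-pred (≰⇒> sM≰cb))
  below′ : ∀ i → i < suc c → i * b < suc M
  below′ i i<sc = s≤s (≤-trans (*-monoˡ-≤ b (≤-pred i<sc)) (≤-reflexive (sym M≡cb)))

expansionSum : ∀ {b} → Expansion b → ℕ
expansionSum ds = sum (map toℕ ds)

expansionSum-zero : ∀ {b} (ds : Expansion b) → fromDigits ds ≡ 0 → expansionSum ds ≡ 0
expansionSum-zero []                _  = refl
expansionSum-zero {suc b} (d ∷ ds) eq =
  cong₂ _+_ (m+n≡0⇒m≡0 (toℕ d) eq)
            (expansionSum-zero ds (m*n≡0⇒m≡0 (fromDigits ds) (suc b) (m+n≡0⇒n≡0 (toℕ d) eq)))

-- Expansions may end in zero digits; digitSum reads the one chosen by toDigits.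
expansionSum-unique : ∀ {b} (ds es : Expansion b) →
  fromDigits ds ≡ fromDigits es → expansionSum ds ≡ expansionSum es
expansionSum-unique []       es       eq = sym (expansionSum-zero es (sym eq))
expansionSum-unique (d ∷ ds) []       eq = expansionSum-zero (d ∷ ds) eq
expansionSum-unique {suc b} (d ∷ ds) (e ∷ es) eq with divMod-unique (toℕ<n d) (toℕ<n e) eq
... | d≡e , ds≡es = cong₂ _+_ d≡e (expansionSum-unique ds es ds≡es)

module _ (b : ℕ) (b≥2 : 2 ≤ b) where

  digitSum-fromDigits : ∀ ds → digitSum b b≥2 (fromDigits ds) ≡ expansionSum ds
  digitSum-fromDigits ds = expansionSum-unique (proj₁ expansion) ds (proj₂ expansion)
    where expansion = toDigits b {fromWitness b≥2} (fromDigits ds)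

  digitSum-zero : digitSum b b≥2 0 ≡ 0
  digitSum-zero = digitSum-fromDigits []

  digitSum-step : ∀ {d} q → d < b → digitSum b b≥2 (d + q * b) ≡ d + digitSum b b≥2 q
  digitSum-step {d} q d<b = begin
    digitSum b b≥2 (d + q * b)
      ≡⟨ cong (digitSum b b≥2) (cong₂ _+_ (toℕ-fromℕ< d<b) (cong (_* b) (proj₂ expansion))) ⟨
    digitSum b b≥2 (fromDigits (fromℕ< d<b ∷ ds))
      ≡⟨ digitSum-fromDigits (fromℕ< d<b ∷ ds) ⟩
    toℕ (fromℕ< d<b) + expansionSum ds
      ≡⟨ cong (_+ expansionSum ds) (toℕ-fromℕ< d<b) ⟩
    d + digitSum b b≥2 q
      ∎
    where
    open ≡-Reasoning
    expansion = toDigits b {fromWitness b≥2} q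
    ds = proj₁ expansion

module _ {A : Set} where

  take-++-≤ : ∀ n (u v : List A) → n ≤ length u → take n (u ++ v) ≡ take n u
  take-++-≤ zero    u       v _         = refl
  take-++-≤ (suc n) (a ∷ u) v (s≤s n≤u) = cong (a ∷_) (take-++-≤ n u v n≤u)

  take-length-++ : ∀ (u v : List A) n → take (length u + n) (u ++ v) ≡ u ++ take n v
  take-length-++ []      v n = refl
  take-length-++ (a ∷ u) v n = cong (a ∷_) (take-length-++ u v n)

  concat-replicate-suc : ∀ n (w : List A) → concat (replicate (suc n) w) ≡ concat (replicate n w) ++ w
  concat-replicate-suc zero    w = ++-identityʳ w
  concat-replicate-suc (suc n) w = begin
    w ++ concat (replicate (suc n) w)   ≡⟨ cong (w ++_) (concat-replicate-suc n w) ⟩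
    w ++ (concat (replicate n w) ++ w)  ≡⟨ ++-assoc w _ w ⟨
    (w ++ concat (replicate n w)) ++ w  ∎
    where open ≡-Reasoning

  length-concat-replicate : ∀ n (w : List A) → length (concat (replicate n w)) ≡ n * length w
  length-concat-replicate zero    w = refl
  length-concat-replicate (suc n) w = trans (length-++ w) (cong (_+_ (length w)) (length-concat-replicate n w))

-- Rational arithmetic

private
  toℚᵘ-/-*-ℕtoℚ : ∀ a d p → ℚ.toℚᵘ (+ a / suc d ℚ.* ℕtoℚ p) ℚᵘ.≃ ℚᵘ.mkℚᵘ (+ a) d ℚᵘ.* ℚᵘ.mkℚᵘ (+ p) 0
  toℚᵘ-/-*-ℕtoℚ a d p = ℚᵘ.≃-trans (ℚ.toℚᵘ-homo-* (+ a / suc d) (ℕtoℚ p))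
    (ℚᵘ.*-cong (ℚ.toℚᵘ-fromℚᵘ (ℚᵘ.mkℚᵘ (+ a) d)) (ℚ.toℚᵘ-fromℚᵘ (ℚᵘ.mkℚᵘ (+ p) 0)))

a*p≡n*d⇒a/d*p≡n : ∀ a d p n → a * p ≡ n * suc d → + a / suc d ℚ.* ℕtoℚ p ≡ ℕtoℚ n
a*p≡n*d⇒a/d*p≡n a d p n a*p≡n*d = ℚ.toℚᵘ-injective (ℚᵘ.≃-trans (toℚᵘ-/-*-ℕtoℚ a d p)
  (ℚᵘ.≃-trans (ℚᵘ.*≡* cross) (ℚᵘ.≃-sym (ℚ.toℚᵘ-fromℚᵘ (ℚᵘ.mkℚᵘ (+ n) 0)))))
  where
  cross : (+ a ℤ.* + p) ℤ.* + 1 ≡ + n ℤ.* + (suc d * 1)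
  cross = begin
    (+ a ℤ.* + p) ℤ.* + 1 ≡⟨ cong (ℤ._* + 1) (ℤ.pos-* a p) ⟨
    + (a * p) ℤ.* + 1     ≡⟨ ℤ.*-identityʳ _ ⟩
    + (a * p)             ≡⟨ cong +_ (trans a*p≡n*d (cong (n *_) (sym (*-identityʳ (suc d))))) ⟩
    + (n * (suc d * 1))   ≡⟨ ℤ.pos-* n _ ⟩
    + n ℤ.* + (suc d * 1) ∎
    where open ≡-Reasoning

r*p≡n∧n*d≤a*p⇒r≤a/d : ∀ r {n a d p} → 0 < p →
  r ℚ.* ℕtoℚ p ≡ ℕtoℚ n → n * suc d ≤ a * p → r ℚ.≤ + a / suc d
r*p≡n∧n*d≤a*p⇒r≤a/d r {n} {a} {d} {suc p} _ r*p≡n n*d≤a*p =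
  ℚ.*-cancelʳ-≤-pos (ℕtoℚ (suc p)) {{ℚ.normalize-pos (suc p) 1}}
    (subst (ℚ._≤ + a / suc d ℚ.* ℕtoℚ (suc p)) (sym r*p≡n) n≤a/d*p)
  where
  cross : + n ℤ.* + (suc d * 1) ℤ.≤ (+ a ℤ.* + suc p) ℤ.* + 1
  cross = subst₂ ℤ._≤_ (ℤ.pos-* n _) (trans (ℤ.pos-* (a * suc p) 1) (cong (ℤ._* + 1) (ℤ.pos-* a (suc p))))
    (ℤ.+≤+ (subst₂ _≤_ (cong (n *_) (sym (*-identityʳ (suc d)))) (sym (*-identityʳ _)) n*d≤a*p))
  n≤a/d*p : ℕtoℚ n ℚ.≤ + a / suc d ℚ.* ℕtoℚ (suc p)
  n≤a/d*p = ℚ.toℚᵘ-cancel-≤ (ℚᵘ.≤-respˡ-≃ (ℚᵘ.≃-sym (ℚ.toℚᵘ-fromℚᵘ (ℚᵘ.mkℚᵘ (+ n) 0)))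
              (ℚᵘ.≤-respʳ-≃ (ℚᵘ.≃-sym (toℚᵘ-/-*-ℕtoℚ a d (suc p))) (ℚᵘ.*≤* cross)))

0<a⇒0<a/d : ∀ {a} d → 0 < a → ℚ.0ℚ ℚ.< + a / suc d
0<a⇒0<a/d {suc a} d _ = ℚ.positive⁻¹ (+ suc a / suc d) {{ℚ.normalize-pos (suc a) (suc d)}}

archimedean : ∀ q → ∃[ n ] q ℚ.< ℕtoℚ (suc n)
archimedean (ℚ.mkℚ (+ k) d _) =
  k , ℚ.toℚᵘ-cancel-< (ℚᵘ.<-respʳ-≃ (ℚᵘ.≃-sym (ℚ.toℚᵘ-fromℚᵘ (ℚᵘ.mkℚᵘ (+ suc k) 0))) (ℚᵘ.*<* cross))
  where
  cross : + k ℤ.* + 1 ℤ.< + suc k ℤ.* + suc d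
  cross = subst₂ ℤ._<_ (ℤ.pos-* k 1) (ℤ.pos-* (suc k) (suc d))
                 (ℤ.+<+ (≤-trans (s≤s (≤-reflexive (*-identityʳ k))) (m≤m*n (suc k) (suc d))))
archimedean (ℚ.mkℚ ℤ.-[1+ k ] d _) =
  0 , ℚ.toℚᵘ-cancel-< (ℚᵘ.<-respʳ-≃ (ℚᵘ.≃-sym (ℚ.toℚᵘ-fromℚᵘ (ℚᵘ.mkℚᵘ (+ 1) 0))) (ℚᵘ.*<* cross))
  where
  cross : ℤ.-[1+ k ] ℤ.* + 1 ℤ.< + 1 ℤ.* + suc d
  cross = subst (ℤ._< + 1 ℤ.* + suc d) (sym (ℤ.*-identityʳ ℤ.-[1+ k ])) ℤ.-<+

-- Periodic windows of infinite words and their powers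

module _ {A : Set} (x : ℕ → A) where

  slice : ℕ → ℕ → List A
  slice k zero    = []
  slice k (suc n) = x k ∷ slice (suc k) n

  length-slice : ∀ k n → length (slice k n) ≡ n
  length-slice k zero    = refl
  length-slice k (suc n) = cong suc (length-slice (suc k) n)

  Periodic : ℕ → ℕ → ℕ → Set
  Periodic k N p = ∀ i → i + p < N → x (k + i) ≡ x (k + (i + p))

  occurs-[] : ∀ k → OccursAt x [] k
  occurs-[] k j ()

  occurs-∷⁺ : ∀ {a u k} → x k ≡ a → OccursAt x u (suc k) → OccursAt x (a ∷ u) k
  occurs-∷⁺ {k = k} xk≡a occ zero    _         = trans (cong x (+-identityʳ k)) xk≡a
  occurs-∷⁺ {k = k} xk≡a occ (suc j) (s≤s j<u) = trans (cong x (+-suc k j)) (occ j j<u)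

  occurs-∷⁻ : ∀ {a u k} → OccursAt x (a ∷ u) k → x k ≡ a × OccursAt x u (suc k)
  occurs-∷⁻ {k = k} occ =
    trans (cong x (sym (+-identityʳ k))) (occ 0 z<s) ,
    λ j j<u → trans (cong x (sym (+-suc k j))) (occ (suc j) (s≤s j<u))

  occurs-++⁺ : ∀ u {v k} → OccursAt x u k → OccursAt x v (k + length u) → OccursAt x (u ++ v) k
  occurs-++⁺ []      {v} {k} _     occ-v = subst (OccursAt x v) (+-identityʳ k) occ-v
  occurs-++⁺ (a ∷ u) {v} {k} occ-au occ-v with occurs-∷⁻ occ-au
  ... | xk≡a , occ-u = occurs-∷⁺ xk≡a (occurs-++⁺ u occ-u (subst (OccursAt x v) (+-suc k (length u)) occ-v))

  occurs-++⁻ʳ : ∀ u {v k} → OccursAt x (u ++ v) k → OccursAt x v (k + length u)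
  occurs-++⁻ʳ []      {v} {k} occ = subst (OccursAt x v) (sym (+-identityʳ k)) occ
  occurs-++⁻ʳ (a ∷ u) {v} {k} occ =
    subst (OccursAt x v) (sym (+-suc k (length u))) (occurs-++⁻ʳ u (proj₂ (occurs-∷⁻ occ)))

  occurs-take : ∀ n u {k} → OccursAt x u k → OccursAt x (take n u) k
  occurs-take zero    u       occ = occurs-[] _
  occurs-take (suc n) []      occ = occ
  occurs-take (suc n) (a ∷ u) occ with occurs-∷⁻ occ
  ... | xk≡a , occ-u = occurs-∷⁺ xk≡a (occurs-take n u occ-u)

  occurs-slice : ∀ k n → OccursAt x (slice k n) k
  occurs-slice k zero    = occurs-[] k
  occurs-slice k (suc n) = occurs-∷⁺ refl (occurs-slice (suc k) n)

  occurs-shift : ∀ {u k N p} → Periodic k N p → length u + p ≤ N → OccursAt x u k → OccursAt x u (k + p)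
  occurs-shift {k = k} {p = p} per u+p≤N occ i i<u = begin
    x (k + p + i)   ≡⟨ cong x (trans (+-assoc k p i) (cong (_+_ k) (+-comm p i))) ⟩
    x (k + (i + p)) ≡⟨ per i (≤-trans (+-monoˡ-< p i<u) u+p≤N) ⟨
    x (k + i)       ≡⟨ occ i i<u ⟩
    _               ∎
    where open ≡-Reasoning

  periodic⇒repetition-occurs : ∀ {k N p} → Periodic k N p →
    ∀ n j → j ≤ N → OccursAt x (take j (concat (replicate n (slice k p)))) k
  periodic⇒repetition-occurs per zero zero    _ = occurs-[] _
  periodic⇒repetition-occurs per zero (suc j) _ = occurs-[] _
  periodic⇒repetition-occurs {k} {N} {p} per (suc n) j j≤N = prefix (j ≤? p)
    where
    w = slice k p
    wⁿ = concat (replicate n w)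
    |w|≡p = length-slice k p
    prefix : Dec (j ≤ p) → OccursAt x (take j (w ++ wⁿ)) k
    prefix (yes j≤p) = subst (λ u → OccursAt x u k) (sym (take-++-≤ j w wⁿ (subst (j ≤_) (sym |w|≡p) j≤p)))
                             (occurs-take j w (occurs-slice k p))
    prefix (no j≰p) = subst (λ u → OccursAt x u k) (sym split) (occurs-++⁺ w (occurs-slice k p) rest-shifted)
      where
      j′ = j ∸ p
      j′+p≡j : j′ + p ≡ j
      j′+p≡j = m∸n+n≡m (<⇒≤ (≰⇒> j≰p))
      split : take j (w ++ wⁿ) ≡ w ++ take j′ wⁿ
      split = trans (cong (λ i → take i (w ++ wⁿ)) j≡|w|+j′) (take-length-++ w wⁿ j′)
        where
        j≡|w|+j′ : j ≡ length w + j′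
        j≡|w|+j′ = trans (sym j′+p≡j) (trans (+-comm j′ p) (cong (_+ j′) (sym |w|≡p)))
      rest : OccursAt x (take j′ wⁿ) k
      rest = periodic⇒repetition-occurs per n j′ (≤-trans (m∸n≤m j p) j≤N)
      |rest|+p≤N : length (take j′ wⁿ) + p ≤ N
      |rest|+p≤N = begin
        length (take j′ wⁿ) + p ≡⟨ cong (_+ p) (length-take j′ wⁿ) ⟩
        j′ ⊓ length wⁿ + p      ≤⟨ +-monoˡ-≤ p (m⊓n≤m j′ _) ⟩
        j′ + p                  ≡⟨ j′+p≡j ⟩
        j                       ≤⟨ j≤N ⟩
        N                       ∎
        where open ≤-Reasoning
      rest-shifted : OccursAt x (take j′ wⁿ) (k + length w)
      rest-shifted = subst (λ l → OccursAt x (take j′ wⁿ) (k + l)) (sym |w|≡p)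
                           (occurs-shift {u = take j′ wⁿ} per |rest|+p≤N rest)

  periodic⇒power-occurs : ∀ {k N p} → Periodic k N p → OccursAt x (ratPow (slice k p) N) k
  periodic⇒power-occurs {N = N} per = periodic⇒repetition-occurs per (suc N) N ≤-refl

  power-occurs⇒periodic : ∀ {w k N} → 0 < length w → OccursAt x (ratPow w N) k → Periodic k N (length w)
  power-occurs⇒periodic {w} {k} {N} 0<p occ i i+p<N = begin
    x (k + i)       ≡⟨ trans (v-at-k i i<|v|) (sym (v-at-k+p i i<|v|)) ⟩
    x (k + p + i)   ≡⟨ cong x (trans (+-assoc k p i) (cong (_+_ k) (+-comm p i))) ⟩
    x (k + (i + p)) ∎
    where
    open ≡-Reasoning
    p = length w
    wᴺ = concat (replicate N w)
    N′ = N ∸ p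
    v = take N′ wᴺ
    p≤N : p ≤ N
    p≤N = ≤-trans (m≤n+m p i) (<⇒≤ i+p<N)
    N′≤|wᴺ| : N′ ≤ length wᴺ
    N′≤|wᴺ| = ≤-trans (m∸n≤m N p)
                (≤-trans (m≤m*n N p {{>-nonZero 0<p}}) (≤-reflexive (sym (length-concat-replicate N w))))
    i<|v| : i < length v
    i<|v| = subst (i <_) (sym (trans (length-take N′ wᴺ) (m≤n⇒m⊓n≡m N′≤|wᴺ|)))
                  (+-cancelʳ-< p i N′ (subst (i + p <_) (sym (m∸n+n≡m p≤N)) i+p<N))
    v-at-k+p : OccursAt x v (k + p)
    v-at-k+p = occurs-++⁻ʳ w (subst (λ u → OccursAt x u k) split occ)
      where
      split : ratPow w N ≡ w ++ v
      split = trans (cong (λ n → take n (w ++ wᴺ)) (sym (m+[n∸m]≡n p≤N)))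
                    (take-length-++ w wᴺ N′)
    v-at-k : OccursAt x v k
    v-at-k = subst (λ u → OccursAt x u k) prefix (occurs-take N′ (ratPow w N) occ)
      where
      prefix : take N′ (ratPow w N) ≡ v
      prefix = begin
        take N′ (take N (concat (replicate (suc N) w))) ≡⟨ take-take N′ N _ ⟩
        take (N′ ⊓ N) (concat (replicate (suc N) w))
          ≡⟨ cong₂ take (m≤n⇒m⊓n≡m (m∸n≤m N p)) (concat-replicate-suc N w) ⟩
        take N′ (wᴺ ++ w)                               ≡⟨ take-++-≤ N′ wᴺ w N′≤|wᴺ| ⟩
        v                                               ∎

  periodic⇒exponent : ∀ {k N p a d} → 0 < p → Periodic k N p → 0 < a → a * p ≡ N * suc d →
    ExponentOf x (+ a / suc d)
  periodic⇒exponent {k} {N} {p} {a} {d} 0<p per 0<a a*p≡N*d =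
    slice k p , 0<|w| , (k , occurs-slice k p) , 0<a⇒0<a/d d 0<a , N , r*|w|≡N , (k , periodic⇒power-occurs per)
    where
    |w|≡p = length-slice k p
    0<|w| : 0 < length (slice k p)
    0<|w| = subst (0 <_) (sym |w|≡p) 0<p
    r*|w|≡N : + a / suc d ℚ.* ℕtoℚ (length (slice k p)) ≡ ℕtoℚ N
    r*|w|≡N = subst (λ l → + a / suc d ℚ.* ℕtoℚ l ≡ ℕtoℚ N) (sym |w|≡p)
                    (a*p≡n*d⇒a/d*p≡n a d p N a*p≡N*d)

  exponent-≤ : ∀ {a d} → (∀ k N p → 0 < p → Periodic k N p → N * suc d ≤ a * p) →
    ∀ r → ExponentOf x r → r ℚ.≤ + a / suc d
  exponent-≤ {a} {d} window-bound r (w , 0<|w| , _ , _ , N , r*|w|≡N , k , occ) =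
    r*p≡n∧n*d≤a*p⇒r≤a/d r {N} {a} {d} 0<|w| r*|w|≡N
      (window-bound k N (length w) 0<|w| (power-occurs⇒periodic {w} {k} {N} 0<|w| occ))

-- The generalized Thue–Morse word

-- b = c + 2, so that suc c is the largest digit b - 1; and m = m′ + 1.
module ThueMorse (c m′ : ℕ) (σ : Fin (suc m′) → Fin (suc m′)) (cyc : IsCyclicPerm σ) (α : Fin (suc m′)) where

  b m : ℕ
  b = suc (suc c)
  m = suc m′

  b≥2 : 2 ≤ b
  b≥2 = s≤s (s≤s z≤n)

  open CyclicPermutation σ cyc

  S : ℕ → ℕ
  S = digitSum b b≥2

  t : ℕ → Fin m
  t = thueMorse b b≥2 σ α

  t-digit : ∀ {d} q → d < b → t (d + q * b) ≡ iter σ d (t q)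
  t-digit {d} q d<b = trans (cong (λ s → iter σ s α) (digitSum-step b b≥2 q d<b)) (iter-+ σ d (S q) α)

  digitSum≡mod[b-1] : ∀ n → ∃[ k ] n ≡ S n + k * suc c
  digitSum≡mod[b-1] = <-rec _ step
    where
    open ≡-Reasoning
    step : ∀ n → (∀ {n′} → n′ < n → ∃[ k ] n′ ≡ S n′ + k * suc c) → ∃[ k ] n ≡ S n + k * suc c
    step zero _ = 0 , sym (trans (+-identityʳ (S 0)) (digitSum-zero b b≥2))
    step n@(suc _) rec with rec (m/n<m n b (s≤s (s≤s z≤n)))
    ... | k , q≡ = k + q , (begin
      n                                  ≡⟨ m≡m%n+[m/n]*n n b ⟩
      r + q * b                          ≡⟨ split r q ⟩
      r + q + q * suc c                  ≡⟨ cong (λ z → r + z + q * suc c) q≡ ⟩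
      r + (S q + k * suc c) + q * suc c  ≡⟨ regroup r (S q) k q ⟩
      (r + S q) + (k + q) * suc c        ≡⟨ cong (_+ (k + q) * suc c) (digitSum-step b b≥2 q (m%n<n n b)) ⟨
      S (r + q * b) + (k + q) * suc c    ≡⟨ cong (λ z → S z + (k + q) * suc c) (m≡m%n+[m/n]*n n b) ⟨
      S n + (k + q) * suc c              ∎)
      where
      r = n % b
      q = n div b
      split : ∀ r q → r + q * suc (suc c) ≡ r + q + q * suc c
      split = solve-∀
      regroup : ∀ r s k q → r + (s + k * suc c) + q * suc c ≡ (r + s) + (k + q) * suc c
      regroup = solve-∀

  t≡σⁿα : m ∣ suc c → ∀ n → t n ≡ iter σ n α
  t≡σⁿα m∣b-1 n with digitSum≡mod[b-1] n
  ... | k , n≡ = begin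
    iter σ (S n) α                      ≡⟨ cong (iter σ (S n)) (∣⇒iter-id (∣-trans m∣b-1 (n∣m*n k)) α) ⟨
    iter σ (S n) (iter σ (k * suc c) α) ≡⟨ iter-+ σ (S n) (k * suc c) α ⟨
    iter σ (S n + k * suc c) α          ≡⟨ cong (λ j → iter σ j α) n≡ ⟨
    iter σ n α                          ∎
    where open ≡-Reasoning

  periodic-everywhere : m ∣ suc c → ∀ N → Periodic t 0 N m
  periodic-everywhere m∣b-1 N i _ = begin
    t i                   ≡⟨ t≡σⁿα m∣b-1 i ⟩
    iter σ i α            ≡⟨ cong (iter σ i) (iter-order α) ⟨
    iter σ i (iter σ m α) ≡⟨ iter-+ σ i m α ⟨
    iter σ (i + m) α      ≡⟨ t≡σⁿα m∣b-1 (i + m) ⟨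
    t (i + m)             ∎
    where open ≡-Reasoning

  Ascent : ℕ → Set
  Ascent n = t (suc n) ≡ σ (t n)

  ascent : ∀ {d} q → suc d < b → Ascent (d + q * b)
  ascent {d} q sd<b = trans (t-digit q sd<b) (cong σ (sym (t-digit q (<-trans (n<1+n d) sd<b))))

  ascent-unless-last-digit : ∀ n → n % b ≢ suc c → Ascent n
  ascent-unless-last-digit n r≢b-1 =
    subst Ascent (sym (m≡m%n+[m/n]*n n b)) (ascent (n div b) (s≤s (≤∧≢⇒< (≤-pred (m%n<n n b)) r≢b-1)))

  descent : ¬ m ∣ suc c → ∀ {d} q → suc d < b → ¬ Ascent (suc c + (d + q * b) * b)
  descent m∤b-1 {d} q sd<b asc = m∤b-1 (iter-fixed⇒∣ (suc c) y (sym y≡σᵇ⁻¹y))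
    where
    open ≡-Reasoning
    y = iter σ (suc d) (t q)
    y≡σᵇ⁻¹y : y ≡ iter σ (suc c) y
    y≡σᵇ⁻¹y = begin
      y                                   ≡⟨ t-digit q sd<b ⟨
      t (suc d + q * b)                   ≡⟨ t-digit (suc (d + q * b)) z<s ⟨
      t (suc (suc c + (d + q * b) * b))   ≡⟨ asc ⟩
      σ (t (suc c + (d + q * b) * b))     ≡⟨ cong σ (t-digit (d + q * b) (n<1+n (suc c))) ⟩
      σ (iter σ (suc c) (t (d + q * b)))  ≡⟨ cong (σ ∘ iter σ (suc c)) (t-digit q (<-trans (n<1+n d) sd<b)) ⟩
      σ (iter σ (suc c) (iter σ d (t q))) ≡⟨ iter-comm σ 1 (suc c) _ ⟩
      iter σ (suc c) y                    ∎

  nonmaximal-digit : ∀ q → ∃[ j ] ∃[ d ] ∃[ a ] (j ≤ 1 × suc d < b × q + j ≡ d + a * b)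
  nonmaximal-digit q with q % b ≟ suc c
  ... | no  r≢b-1 = 0 , q % b , q div b , z≤n , s≤s (≤∧≢⇒< (≤-pred (m%n<n q b)) r≢b-1) ,
                    trans (+-identityʳ q) (m≡m%n+[m/n]*n q b)
  ... | yes r≡b-1 = 1 , 0 , suc (q div b) , ≤-refl , s≤s (s≤s z≤n) ,
                    trans (+-comm q 1) (cong suc (trans (m≡m%n+[m/n]*n q b) (cong (_+ q div b * b) r≡b-1)))

  -- k + i is the first or second position from k on whose last digit is b − 1, chosen so
  -- that its next digit is not b − 1.
  descent-within-2b : ¬ m ∣ suc c → ∀ k → ∃[ i ] (i < 2 * b × ¬ Ascent (k + i))
  descent-within-2b m∤b-1 k with nonmaximal-digit (k div b)
  ... | j , d , a , j≤1 , sd<b , k/b+j≡ = i , i<2b , λ asc → descent m∤b-1 a sd<b (subst Ascent k+i≡ asc)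
    where
    open ≡-Reasoning
    i = (suc c ∸ k % b) + j * b
    i<2b : i < 2 * b
    i<2b = +-mono-≤ (s≤s (m∸n≤m (suc c) (k % b))) (*-monoˡ-≤ b j≤1)
    rearrange : ∀ r q s j c → r + q * suc (suc c) + (s + j * suc (suc c)) ≡ (r + s) + (q + j) * suc (suc c)
    rearrange = solve-∀
    k+i≡ : k + i ≡ suc c + (d + a * b) * b
    k+i≡ = begin
      k + i
        ≡⟨ cong (_+ i) (m≡m%n+[m/n]*n k b) ⟩
      k % b + k div b * b + i
        ≡⟨ rearrange (k % b) (k div b) (suc c ∸ k % b) j c ⟩
      (k % b + (suc c ∸ k % b)) + (k div b + j) * b
        ≡⟨ cong₂ (λ u v → u + v * b) (m+[n∸m]≡n (≤-pred (m%n<n k b))) k/b+j≡ ⟩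
      suc c + (d + a * b) * b
        ∎

  -- n and n + p cannot both end in the digit b − 1 when b ∤ p.
  ascent-or-shifted : ∀ p → p % b ≢ 0 → ∀ n → Ascent n ⊎ Ascent (n + p)
  ascent-or-shifted p p%b≢0 n with n % b ≟ suc c | (n + p) % b ≟ suc c
  ... | no  r≢b-1 | _          = inj₁ (ascent-unless-last-digit n r≢b-1)
  ... | yes _     | no r′≢b-1  = inj₂ (ascent-unless-last-digit (n + p) r′≢b-1)
  ... | yes r≡b-1 | yes r′≡b-1 = ⊥-elim (p%b≢0 (begin
    p % b                   ≡⟨ [m+kn]%n≡m%n p (n div b) b ⟨
    (p + n div b * b) % b   ≡⟨ cong (_% b) p+n≡ ⟩
    ((n + p) div b * b) % b ≡⟨ m*n%n≡0 ((n + p) div b) b ⟩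
    0                       ∎))
    where
    open ≡-Reasoning
    p+n≡ : p + n div b * b ≡ (n + p) div b * b
    p+n≡ = +-cancelˡ-≡ (suc c) _ _ (begin
      suc c + (p + n div b * b)       ≡⟨ cong (_+_ (suc c)) (+-comm p _) ⟩
      suc c + (n div b * b + p)       ≡⟨ +-assoc (suc c) _ p ⟨
      suc c + n div b * b + p         ≡⟨ cong (λ r → r + n div b * b + p) r≡b-1 ⟨
      n % b + n div b * b + p         ≡⟨ cong (_+ p) (m≡m%n+[m/n]*n n b) ⟨
      n + p                           ≡⟨ m≡m%n+[m/n]*n (n + p) b ⟩
      (n + p) % b + (n + p) div b * b ≡⟨ cong (_+ (n + p) div b * b) r′≡b-1 ⟩
      suc c + (n + p) div b * b       ∎)

  periodic-ascent : ∀ {k N p i} → Periodic t k N p → suc i + p < N → Ascent (k + i) ≡ Ascent (k + (i + p))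
  periodic-ascent {k} {N} {p} {i} per si+p<N =
    cong₂ (λ u v → u ≡ σ v) next (per i (<-trans (n<1+n (i + p)) si+p<N))
    where
    next : t (suc (k + i)) ≡ t (suc (k + (i + p)))
    next = trans (cong t (sym (+-suc k i))) (trans (per (suc i) si+p<N) (cong t (+-suc k (i + p))))

  periodic-all-ascents : ∀ {k N p} → p % b ≢ 0 → Periodic t k N p → 2 * p < N →
    ∀ i → suc i < N → Ascent (k + i)
  periodic-all-ascents {k} {N} {p} p%b≢0 per 2p<N i si<N with i <? p
  ... | yes i<p = [ (λ asc → asc) , backward ]′ (ascent-or-shifted p p%b≢0 (k + i))
    where
    si+p<N : suc i + p < N
    si+p<N = ≤-<-trans (≤-trans (+-monoˡ-≤ p i<p) (≤-reflexive (cong (_+_ p) (sym (+-identityʳ p))))) 2p<N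
    backward : Ascent (k + i + p) → Ascent (k + i)
    backward asc = subst id (sym (periodic-ascent {k} {N} {p} {i} per si+p<N)) (subst Ascent (+-assoc k i p) asc)
  ... | no i≮p = subst (λ j → Ascent (k + j)) i′+p≡i
                   ([ forward , subst Ascent (+-assoc k i′ p) ]′ (ascent-or-shifted p p%b≢0 (k + i′)))
    where
    i′ = i ∸ p
    i′+p≡i : i′ + p ≡ i
    i′+p≡i = m∸n+n≡m (≮⇒≥ i≮p)
    forward : Ascent (k + i′) → Ascent (k + (i′ + p))
    forward = subst id (periodic-ascent {k} {N} {p} {i′} per (subst (λ j → suc j < N) (sym i′+p≡i) si<N))

  ascents⇒orbit : ∀ {k N} → (∀ i → suc i < N → Ascent (k + i)) → ∀ j → j < N → t (k + j) ≡ iter σ j (t k)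
  ascents⇒orbit {k} asc zero    _    = cong t (+-identityʳ k)
  ascents⇒orbit {k} asc (suc j) sj<N =
    trans (cong t (+-suc k j)) (trans (asc j sj<N) (cong σ (ascents⇒orbit {k} asc j (<-trans (n<1+n j) sj<N))))

  periodic-blocks : ∀ q {k N} → Periodic t k N (q * b) → q * b < N →
    ∃[ k′ ] ∃[ N′ ] (Periodic t k′ N′ q × N ≤ N′ * b)
  periodic-blocks q {k} {N} per qb<N with ceiling-multiple b (N ∸ q * b)
  ... | c′ , M≤c′b , below = k div b , c′ + q , per′ , N≤
    where
    N≤ : N ≤ (c′ + q) * b
    N≤ = begin
      N                     ≡⟨ m∸n+n≡m (<⇒≤ qb<N) ⟨
      (N ∸ q * b) + q * b   ≤⟨ +-monoˡ-≤ (q * b) M≤c′b ⟩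
      c′ * b + q * b        ≡⟨ *-distribʳ-+ b c′ q ⟨
      (c′ + q) * b          ∎
      where open ≤-Reasoning
    -- Both ends of the periodicity step below carry the last digit k % b.
    per′ : Periodic t (k div b) (c′ + q) q
    per′ i i+q<c′+q = iter-injective σ (proj₁ cyc) (k % b) (begin
      iter σ (k % b) (t (k div b + i))       ≡⟨ t-digit (k div b + i) (m%n<n k b) ⟨
      t (k % b + (k div b + i) * b)          ≡⟨ cong t (block-position k i) ⟨
      t (k + i * b)                          ≡⟨ per (i * b) ib+qb<N ⟩
      t (k + (i * b + q * b))                ≡⟨ cong (λ z → t (k + z)) (*-distribʳ-+ b i q) ⟨
      t (k + (i + q) * b)                    ≡⟨ cong t (block-position k (i + q)) ⟩
      t (k % b + (k div b + (i + q)) * b)    ≡⟨ t-digit (k div b + (i + q)) (m%n<n k b) ⟩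
      iter σ (k % b) (t (k div b + (i + q))) ∎)
      where
      open ≡-Reasoning
      ib+qb<N : i * b + q * b < N
      ib+qb<N = subst (i * b + q * b <_) (m∸n+n≡m (<⇒≤ qb<N))
                      (+-monoˡ-< (q * b) (below i (+-cancelʳ-< q i c′ i+q<c′+q)))

  module _ (m∤b-1 : ¬ m ∣ suc c) where

    Bound : ℕ → Set
    Bound p = ∀ k N → Periodic t k N p → m * N ≤ 2 * (b ⊔ m) * p

    bound-indivisible : ∀ p → 0 < p → p % b ≢ 0 → Bound p
    bound-indivisible p 0<p p%b≢0 k N per with N ≤? 2 * p
    ... | yes N≤2p = begin
      m * N           ≤⟨ *-monoʳ-≤ m N≤2p ⟩
      m * (2 * p)     ≡⟨ *-assoc m 2 p ⟨
      m * 2 * p       ≡⟨ cong (_* p) (*-comm m 2) ⟩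
      2 * m * p       ≤⟨ *-monoˡ-≤ p (*-monoʳ-≤ 2 (m≤n⊔m b m)) ⟩
      2 * (b ⊔ m) * p ∎
      where open ≤-Reasoning
    ... | no N≰2p = begin
      m * N           ≤⟨ *-monoʳ-≤ m N≤2b ⟩
      m * (2 * b)     ≤⟨ *-monoˡ-≤ (2 * b) m≤p ⟩
      p * (2 * b)     ≡⟨ *-comm p (2 * b) ⟩
      2 * b * p       ≤⟨ *-monoˡ-≤ p (*-monoʳ-≤ 2 (m≤m⊔n b m)) ⟩
      2 * (b ⊔ m) * p ∎
      where
      open ≤-Reasoning
      2p<N : 2 * p < N
      2p<N = ≰⇒> N≰2p
      ascents : ∀ i → suc i < N → Ascent (k + i)
      ascents = periodic-all-ascents {k} {N} {p} p%b≢0 per 2p<N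
      N≤2b : N ≤ 2 * b
      N≤2b = ≮⇒≥ λ 2b<N → let i , i<2b , ¬ascent = descent-within-2b m∤b-1 k
                           in ¬ascent (ascents i (≤-<-trans i<2b 2b<N))
      p<N : p < N
      p<N = ≤-<-trans (m≤m+n p (p + 0)) 2p<N
      m≤p : m ≤ p
      m≤p = ∣⇒≤ {{>-nonZero 0<p}} (iter-fixed⇒∣ p (t k)
              (trans (sym (ascents⇒orbit {k} {N} ascents p p<N)) (trans (sym (per 0 p<N)) (cong t (+-identityʳ k)))))

    bound-divisible : ∀ q → Bound q → Bound (q * b)
    bound-divisible q bound-q k N per with N ≤? q * b
    ... | yes N≤qb = begin
      m * N                 ≤⟨ *-monoʳ-≤ m N≤qb ⟩
      m * (q * b)           ≤⟨ *-monoˡ-≤ (q * b) (≤-trans (m≤n⊔m b m) (m≤m+n (b ⊔ m) _)) ⟩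
      2 * (b ⊔ m) * (q * b) ∎
      where open ≤-Reasoning
    ... | no N≰qb = let k′ , N′ , per′ , N≤N′b = periodic-blocks q {k} {N} per (≰⇒> N≰qb) in begin
      m * N                 ≤⟨ *-monoʳ-≤ m N≤N′b ⟩
      m * (N′ * b)          ≡⟨ *-assoc m N′ b ⟨
      m * N′ * b            ≤⟨ *-monoˡ-≤ b (bound-q k′ N′ per′) ⟩
      2 * (b ⊔ m) * q * b   ≡⟨ *-assoc (2 * (b ⊔ m)) q b ⟩
      2 * (b ⊔ m) * (q * b) ∎
      where open ≤-Reasoning

    periodic-bound : ∀ p → 0 < p → Bound p
    periodic-bound = <-rec (λ p → 0 < p → Bound p) step
      where
      step : ∀ p → (∀ {q} → q < p → 0 < q → Bound q) → 0 < p → Bound p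
      step p rec 0<p with p % b ≟ 0
      ... | no  p%b≢0 = bound-indivisible p 0<p p%b≢0
      ... | yes p%b≡0 = subst Bound (m/n*n≡m b∣p) (bound-divisible (p div b) (rec q<p 0<q))
        where
        instance _ = >-nonZero 0<p
        b∣p : b ∣ p
        b∣p = m%n≡0⇒n∣m p b p%b≡0
        q<p : p div b < p
        q<p = m/n<m p b (s≤s (s≤s z≤n))
        0<q : 0 < p div b
        0<q = m≥n⇒m/n>0 (∣⇒≤ b∣p)

  periodic-bound-m<b : ¬ m ∣ suc c → m < b → ∀ k N p → 0 < p → Periodic t k N p → N * m ≤ 2 * b * p
  periodic-bound-m<b m∤b-1 m<b k N p 0<p per =
    subst₂ _≤_ (*-comm m N) (cong (λ K → 2 * K * p) (m≥n⇒m⊔n≡m (<⇒≤ m<b)))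
               (periodic-bound m∤b-1 p 0<p k N per)

  periodic-bound-b≤m : b ≤ m → ∀ k N p → 0 < p → Periodic t k N p → N * 1 ≤ 2 * p
  periodic-bound-b≤m b≤m k N p 0<p per =
    subst (_≤ 2 * p) (sym (*-identityʳ N)) (*-cancelˡ-≤ m (begin
    m * N           ≤⟨ periodic-bound m∤b-1 p 0<p k N per ⟩
    2 * (b ⊔ m) * p ≡⟨ cong (λ K → 2 * K * p) (m≤n⇒m⊔n≡n b≤m) ⟩
    2 * m * p       ≡⟨ cong (_* p) (*-comm 2 m) ⟩
    m * 2 * p       ≡⟨ *-assoc m 2 p ⟩
    m * (2 * p)     ∎))
    where
    open ≤-Reasoning
    m∤b-1 : ¬ m ∣ suc c
    m∤b-1 m∣b-1 = <-irrefl refl (≤-trans b≤m (∣⇒≤ m∣b-1))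

  square-at-1 : Periodic t 1 (2 * suc c) (suc c)
  square-at-1 i i+b-1<2[b-1] = begin
    t (1 + i)                 ≡⟨ cong t (+-identityʳ (suc i)) ⟨
    t (suc i + 0 * b)         ≡⟨ t-digit 0 (s≤s i<b-1) ⟩
    iter σ (suc i) (t 0)      ≡⟨ iter-comm σ i 1 (t 0) ⟨
    iter σ i (iter σ 1 (t 0)) ≡⟨ cong (iter σ i) (t-digit 0 (s≤s (s≤s z≤n))) ⟨
    iter σ i (t 1)            ≡⟨ t-digit 1 (<-trans i<b-1 (n<1+n (suc c))) ⟨
    t (i + 1 * b)             ≡⟨ cong t (trans (cong (_+_ i) (+-identityʳ b)) (+-suc i (suc c))) ⟩
    t (1 + (i + suc c))       ∎
    where
    open ≡-Reasoning
    i<b-1 : i < suc c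
    i<b-1 = +-cancelʳ-< (suc c) i (suc c)
              (subst (i + suc c <_) (cong (_+_ (suc c)) (+-identityʳ (suc c))) i+b-1<2[b-1])

  allMaxDigits : ℕ → ℕ
  allMaxDigits zero    = 0
  allMaxDigits (suc j) = suc c + allMaxDigits j * b

  digitSum-allMaxDigits : ∀ j → S (allMaxDigits j) ≡ j * suc c
  digitSum-allMaxDigits zero    = digitSum-zero b b≥2
  digitSum-allMaxDigits (suc j) =
    trans (digitSum-step b b≥2 (allMaxDigits j) (n<1+n (suc c))) (cong (_+_ (suc c)) (digitSum-allMaxDigits j))

  digitSum-suc-allMaxDigits : ∀ j → S (suc (allMaxDigits j)) ≡ 1
  digitSum-suc-allMaxDigits zero    = cong suc (digitSum-zero b b≥2)
  digitSum-suc-allMaxDigits (suc j) =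
    trans (digitSum-step b b≥2 {0} (suc (allMaxDigits j)) z<s) (digitSum-suc-allMaxDigits j)

  -- Past the m − 1 digits b − 1 the digit sum grows by one per step, except for the carry
  -- at the block boundary, which is invisible modulo m; so t follows an orbit of σ for 2b steps.
  t-after-allMaxDigits : ∀ j → j < 2 * b → t (allMaxDigits m′ * b + j) ≡ iter σ (j + m′ * suc c) α
  t-after-allMaxDigits j j<2b with j <? b
  ... | yes j<b = cong (λ s → iter σ s α) (begin
    S (Q * b + j)  ≡⟨ cong S (+-comm (Q * b) j) ⟩
    S (j + Q * b)  ≡⟨ digitSum-step b b≥2 Q j<b ⟩
    j + S Q        ≡⟨ cong (_+_ j) (digitSum-allMaxDigits m′) ⟩
    j + m′ * suc c ∎)
    where
    open ≡-Reasoning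
    Q = allMaxDigits m′
  ... | no j≮b = begin
    t (Q * b + j)                         ≡⟨ cong (λ i → t (Q * b + i)) b+d≡j ⟨
    t (Q * b + (b + d))                   ≡⟨ cong t (rearrange Q d c) ⟩
    t (d + suc Q * b)                     ≡⟨ cong (λ s → iter σ s α) S≡d+1 ⟩
    iter σ (d + 1) α                      ≡⟨ cong (iter σ (d + 1)) (iter-*-id σ {m} iter-order (suc c) α) ⟨
    iter σ (d + 1) (iter σ (suc c * m) α) ≡⟨ iter-+ σ (d + 1) (suc c * m) α ⟨
    iter σ (d + 1 + suc c * m) α          ≡⟨ cong (λ s → iter σ s α) (exponent-shift d m′ c) ⟩
    iter σ (b + d + m′ * suc c) α         ≡⟨ cong (λ i → iter σ (i + m′ * suc c) α) b+d≡j ⟩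
    iter σ (j + m′ * suc c) α             ∎
    where
    open ≡-Reasoning
    Q = allMaxDigits m′
    d = j ∸ b
    b+d≡j : b + d ≡ j
    b+d≡j = m+[n∸m]≡n (≮⇒≥ j≮b)
    d<b : d < b
    d<b = +-cancelˡ-< b d b (subst (_< b + b) (sym b+d≡j) (subst (j <_) (cong (_+_ b) (+-identityʳ b)) j<2b))
    S≡d+1 : S (d + suc Q * b) ≡ d + 1
    S≡d+1 = trans (digitSum-step b b≥2 (suc Q) d<b) (cong (_+_ d) (digitSum-suc-allMaxDigits m′))
    rearrange : ∀ Q d c → Q * suc (suc c) + (suc (suc c) + d) ≡ d + suc Q * suc (suc c)
    rearrange = solve-∀
    exponent-shift : ∀ d m′ c → d + 1 + suc c * suc m′ ≡ suc (suc c) + d + m′ * suc c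
    exponent-shift = solve-∀

  periodic-after-allMaxDigits : Periodic t (allMaxDigits m′ * b) (2 * b) m
  periodic-after-allMaxDigits i i+m<2b = begin
    t (Q * b + i)                ≡⟨ t-after-allMaxDigits i (≤-trans (s≤s (m≤m+n i m)) i+m<2b) ⟩
    iter σ (i + X) α             ≡⟨ cong (iter σ (i + X)) (iter-order α) ⟨
    iter σ (i + X) (iter σ m α)  ≡⟨ iter-+ σ (i + X) m α ⟨
    iter σ (i + X + m) α         ≡⟨ cong (λ s → iter σ s α) (swap i X m) ⟩
    iter σ (i + m + X) α         ≡⟨ t-after-allMaxDigits (i + m) i+m<2b ⟨
    t (Q * b + (i + m))          ∎
    where
    open ≡-Reasoning
    Q = allMaxDigits m′
    X = m′ * suc c
    swap : ∀ i X m → i + X + m ≡ i + m + X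
    swap = solve-∀

theorem4p4 : (b m : ℕ) → (b≥2 : 2 ≤ b) → .{{_ : NonZero m}} →
    (σ : Fin m → Fin m) → IsCyclicPerm σ → (α : Fin m) →
    (m ∣ (b ∸ 1) → CritExpInfinite (thueMorse b b≥2 σ α)) ×
    (¬ (m ∣ (b ∸ 1)) → m < b → CritExpEquals (thueMorse b b≥2 σ α) ((+ (2 * b)) / m)) ×
    (b ≤ m → CritExpEquals (thueMorse b b≥2 σ α) ((+ 2) / 1))
theorem4p4 _ zero _ _ _ ()
theorem4p4 (suc (suc c)) (suc m′) (s≤s (s≤s z≤n)) σ cyc α = unbounded , m<b-case , b≤m-case
  where
  open ThueMorse c m′ σ cyc α

  unbounded : m ∣ suc c → CritExpInfinite t
  unbounded m∣b-1 q with archimedean q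
  ... | n , q<n+1 = ℕtoℚ (suc n) , exponent , q<n+1
    where
    exponent = periodic⇒exponent t {0} {suc n * m} {m} {suc n} {0}
                 z<s (periodic-everywhere m∣b-1 (suc n * m)) z<s (sym (*-identityʳ _))

  m<b-case : ¬ m ∣ suc c → m < b → CritExpEquals t (+ (2 * b) / m)
  m<b-case m∤b-1 m<b = exponent-≤ t {2 * b} {m′} (periodic-bound-m<b m∤b-1 m<b) ,
    λ q q<2b/m → _ , periodic⇒exponent t {allMaxDigits m′ * b} {2 * b} {m} {2 * b} {m′}
                       z<s periodic-after-allMaxDigits z<s refl , q<2b/m

  b≤m-case : b ≤ m → CritExpEquals t (+ 2 / 1)
  b≤m-case b≤m = exponent-≤ t {2} {0} (periodic-bound-b≤m b≤m) ,
    λ q q<2 → _ , periodic⇒exponent t {1} {2 * suc c} {suc c} {2} {0}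
                    z<s square-at-1 z<s (sym (*-identityʳ _)) , q<2
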